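{- Let $f_n(x)=\sum_{[\pi]\in\mathfrak{C}_n^o}x^{\operatorname{drop}_{oo}([\pi])}$. Then $f_1=1$ and for every $n\ge1$: (i) $f_{2n}=nf_{2n-1}-x\frac{d}{dx}f_{2n-1}+\frac{d}{dx}f_{2n-1}$; (ii) $f_{2n+1}=nxf_{2n}-x^2\frac{d}{dx}f_{2n}+x\frac{d}{dx}f_{2n}$.
   Context: Let $\mathfrak{S}_n$ be the set of permutations of $[n]=\{1,\dots,n\}$, written as words $\pi=\pi_1\cdots\pi_n$. Two permutations are equivalent if one is a cyclic rotation of the other; a cycle $[\pi]$ on $[n]$ is an equivalence class, and $\mathfrak{C}_n$ is the set of cycles on $[n]$. Choose the representative with $\pi_1=1$ and read indices cyclically ($\pi_{n+1}=\pi_1$). A drop of $[\pi]$ is a pair $(\pi_i,\pi_{i+1})$, $1\le i\le n$, with $\pi_i>\pi_{i+1}$. A drop is odd-odd if both entries are odd; $\operatorname{drop}_{oo}([\pi])$ is the number of odd-odd drops of $[\pi]$. By convention, the unique cycle $[(1)]$ on $[1]$ has exactly one drop $(\star,1)$, where $\star$ is considered neither even nor odd (so this drop is not odd-odd, but its second entry is odd). $\mathfrak{C}_n^o=\{[\pi]\in\mathfrak{C}_n:\ \pi_{i+1}\text{ is odd for every drop }(\pi_i,\pi_{i+1})\text{ of }[\pi]\}$. -}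

module Defs where

open import Data.Bool using (Bool; true; false; _∧_; if_then_else_)
open import Data.Nat as ℕ using (ℕ; zero; suc; _<ᵇ_; _≡ᵇ_; _%_)
open import Data.Integer as ℤ using (ℤ; +_)
open import Data.List using (List; []; _∷_; map; concatMap; filter; length; upTo)
open import Relation.Binary.PropositionalEquality using (_≡_)
open import Data.Product using (_×_; _,_)
open import Relation.Nullary.Decidable using (yes; no)
open import Data.Bool.Properties using (T?)

odd : ℕ → Bool
odd n = (n % 2) ≡ᵇ 1

insertions : ℕ → List ℕ → List (List ℕ)
insertions x [] = (x ∷ []) ∷ []
insertions x (y ∷ ys) = (x ∷ y ∷ ys) ∷ map (y ∷_) (insertions x ys)

perms : List ℕ → List (List ℕ)
perms [] = [] ∷ []
perms (x ∷ xs) = concatMap (insertions x) (perms xs)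

-- cycles on [n], each given by its unique representative word with π₁ = 1:
-- 1 followed by a permutation of 2,…,n  (for n = 0: no cycles)
cycles : ℕ → List (List ℕ)
cycles zero = []
cycles (suc n) = map (1 ∷_) (perms (map (λ i → suc (suc i)) (upTo n)))

-- consecutive pairs (π_i, π_{i+1}) for i = 1..n, read cyclically (π_{n+1} = π_1)
pairsFrom : ℕ → List ℕ → List (ℕ × ℕ)
pairsFrom h [] = []
pairsFrom h (x ∷ []) = (x , h) ∷ []
pairsFrom h (x ∷ y ∷ ys) = (x , y) ∷ pairsFrom h (y ∷ ys)

cyclicPairs : List ℕ → List (ℕ × ℕ)
cyclicPairs [] = []
cyclicPairs (h ∷ t) = pairsFrom h (h ∷ t)

isDrop : ℕ × ℕ → Bool
isDrop (a , b) = b <ᵇ a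

drops : List ℕ → List (ℕ × ℕ)
drops π = filter (λ p → T? (isDrop p)) (cyclicPairs π)

isOddOdd : ℕ × ℕ → Bool
isOddOdd (a , b) = odd a ∧ odd b

dropoo : List ℕ → ℕ
dropoo π = length (filter (λ p → T? (isOddOdd p)) (drops π))

inCo : List ℕ → Bool
inCo π = allB (drops π)
  where
  allB : List (ℕ × ℕ) → Bool
  allB [] = true
  allB ((a , b) ∷ ps) = odd b ∧ allB ps

Poly : Set
Poly = ℕ → ℤ

f : ℕ → Poly
f n k = + length (filter (λ π → T? (inCo π ∧ (dropoo π ≡ᵇ k))) (cycles n))

one : Poly
one zero = + 1
one (suc k) = + 0

D : Poly → Poly
D p k = + suc k ℤ.* p (suc k)

X : Poly → Poly
X p zero = + 0
X p (suc k) = p k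

_·_ : ℤ → Poly → Poly
(c · p) k = c ℤ.* p k

_⊕_ : Poly → Poly → Poly
(p ⊕ q) k = p k ℤ.+ q k

_⊖_ : Poly → Poly → Poly
(p ⊖ q) k = p k ℤ.- q k

infixl 6 _⊕_ _⊖_
infixr 7 _·_

_≋_ : Poly → Poly → Set
p ≋ q = ∀ k → p k ≡ q k

infix 4 _≋_

-- Every cycle on [j + 2] arises exactly once from a cycle on [j + 1] by inserting the maximum
-- m = j + 2, i.e. by replacing one consecutive pair (a , b) by (a , m) and (m , b).  The pair
-- (a , m) is no drop and (m , b) is a drop, so the new cycle lies in ℭᵒ iff the old one did and b
-- is odd; it loses the drop (a , b) if that was odd-odd and gains an odd-odd drop iff m is odd.
-- A cycle with c odd-odd drops has N pairs whose second entry is odd, N being the number of odd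
-- values in [j + 1], and its c odd-odd drops are among them.  So it contributes
-- x^[m odd] ((N − c) x^c + c x^(c − 1)), and summing gives f_{j+2} = x^[m odd] (N f − x f′ + f′)
-- with f = f_{j+1}; for j + 2 = 2n and j + 2 = 2n + 1 the number N is n.

module Submission where

open import Defs
open import Data.Bool using (Bool; true; false; T; _∧_; if_then_else_)
open import Data.Bool.ListAction using (all)
open import Data.Bool.Properties using (T?; ∧-assoc; ∧-zeroʳ; ∧-identityʳ)
open import Data.Integer as ℤ using (+_)
import Data.Integer.Properties as ℤ
import Data.Integer.Tactic.RingSolver as ℤ-Solver
open import Data.List using (List; []; _∷_; _++_; _∷ʳ_; map; concatMap; filter; length; upTo)
open import Data.List.Properties using (map-++; map-∘; map-cong; upTo-∷ʳ; concatMap-++)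
open import Data.List.Relation.Unary.All using (All; []; _∷_)
import Data.List.Relation.Unary.All as All
open import Data.List.Relation.Unary.All.Properties
  using (applyUpTo⁺₁) renaming (map⁺ to All-map⁺; ++⁺ to All-++⁺)
open import Data.List.Relation.Binary.Permutation.Propositional using (_↭_; ↭-refl; ↭-sym; ↭-trans; prep; swap)
import Data.List.Relation.Binary.Permutation.Propositional as Perm
open import Data.List.Relation.Binary.Permutation.Propositional.Properties
  using (All-resp-↭; map⁺; ++⁺ˡ; ++⁺; shifts; ∷↭∷ʳ)
open import Data.Nat using (ℕ; zero; suc; _+_; _*_; _∸_; _≤_; _<_; _<ᵇ_; _≡ᵇ_; _%_; s≤s; z≤n)
open import Data.Nat.DivMod using ([m+kn]%n≡m%n)
open import Data.Nat.ListAction using (sum)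
open import Data.Nat.ListAction.Properties using (sum-++; sum-↭)
open import Data.Nat.Properties using (+-assoc; +-comm; +-suc; +-identityʳ; *-comm; *-suc; *-zeroʳ; <⇒≤; ≡ᵇ⇒≡)
import Data.Nat.Tactic.RingSolver as ℕ-Solver
open import Data.Product using (_×_; _,_; proj₁; proj₂)
open import Function using (_∘_)
open import Relation.Binary.PropositionalEquality

private variable A B : Set

𝟙 : Bool → ℕ
𝟙 true  = 1
𝟙 false = 0

𝟙-∧ : ∀ x y → 𝟙 (x ∧ y) ≡ 𝟙 x * 𝟙 y
𝟙-∧ false y = refl
𝟙-∧ true  y = sym (+-identityʳ (𝟙 y))

*-𝟙-≡ᵇ : ∀ m n b → m * 𝟙 (b ∧ (m ≡ᵇ n)) ≡ n * 𝟙 (b ∧ (m ≡ᵇ n))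
*-𝟙-≡ᵇ m n false = trans (*-zeroʳ m) (sym (*-zeroʳ n))
*-𝟙-≡ᵇ m n true with m ≡ᵇ n in eq
... | false = trans (*-zeroʳ m) (sym (*-zeroʳ n))
... | true  = cong (_* 1) (≡ᵇ⇒≡ m n (subst T (sym eq) _))

count : (A → Bool) → List A → ℕ
count p xs = sum (map (𝟙 ∘ p) xs)

length-filter : (p : A → Bool) (xs : List A) → length (filter (T? ∘ p) xs) ≡ count p xs
length-filter p [] = refl
length-filter p (x ∷ xs) with p x
... | true  = cong suc (length-filter p xs)
... | false = length-filter p xs

length-filter-filter : (p q : A → Bool) (xs : List A) →
  length (filter (T? ∘ q) (filter (T? ∘ p) xs)) ≡ count (λ x → p x ∧ q x) xs
length-filter-filter p q [] = refl
length-filter-filter p q (x ∷ xs) with p x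
... | false = length-filter-filter p q xs
... | true with q x
...   | true  = cong suc (length-filter-filter p q xs)
...   | false = length-filter-filter p q xs

count-++ : (p : A → Bool) (xs ys : List A) → count p (xs ++ ys) ≡ count p xs + count p ys
count-++ p xs ys = trans (cong sum (map-++ (𝟙 ∘ p) xs ys)) (sum-++ (map (𝟙 ∘ p) xs) _)

count-map : (p : B → Bool) (g : A → B) (xs : List A) → count p (map g xs) ≡ count (p ∘ g) xs
count-map p g xs = cong sum (sym (map-∘ xs))

count-cong : {p q : A → Bool} → (∀ x → p x ≡ q x) → (xs : List A) → count p xs ≡ count q xs
count-cong p≗q xs = cong sum (map-cong (cong 𝟙 ∘ p≗q) xs)

count-cong-All : {p q : A → Bool} {xs : List A} → All (λ x → p x ≡ q x) xs → count p xs ≡ count q xs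
count-cong-All []            = refl
count-cong-All (px≡qx ∷ eqs) = cong₂ _+_ (cong 𝟙 px≡qx) (count-cong-All eqs)

count-↭ : (p : A → Bool) {xs ys : List A} → xs ↭ ys → count p xs ≡ count p ys
count-↭ p xs↭ys = sum-↭ (map⁺ (𝟙 ∘ p) xs↭ys)

count-concatMap : (p : B → Bool) (g : A → List B) (xs : List A) →
  count p (concatMap g xs) ≡ sum (map (count p ∘ g) xs)
count-concatMap p g []       = refl
count-concatMap p g (x ∷ xs) =
  trans (count-++ p (g x) (concatMap g xs)) (cong (λ n → count p (g x) + n) (count-concatMap p g xs))

sum-map-linear : (c a b : A → ℕ) (k n s : ℕ) {xs : List A} →
  All (λ x → c x + k * a x ≡ n * a x + s * b x) xs →
  sum (map c xs) + k * sum (map a xs) ≡ n * sum (map a xs) + s * sum (map b xs)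
sum-map-linear c a b k n s [] rewrite *-zeroʳ k | *-zeroʳ n | *-zeroʳ s = refl
sum-map-linear c a b k n s {x ∷ xs} (e ∷ es) = begin
    (c x + C) + k * (a x + Σa)
  ≡⟨ regroupˡ (c x) C k (a x) Σa ⟩
    (c x + k * a x) + (C + k * Σa)
  ≡⟨ cong₂ _+_ e (sum-map-linear c a b k n s es) ⟩
    (n * a x + s * b x) + (n * Σa + s * Σb)
  ≡⟨ regroupʳ n s (a x) (b x) Σa Σb ⟩
    n * (a x + Σa) + s * (b x + Σb) ∎
  where
  open ≡-Reasoning
  C = sum (map c xs)
  Σa = sum (map a xs)
  Σb = sum (map b xs)
  regroupˡ : ∀ c C k a A → (c + C) + k * (a + A) ≡ (c + k * a) + (C + k * A)
  regroupˡ = ℕ-Solver.solve-∀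
  regroupʳ : ∀ n s a b A B → (n * a + s * b) + (n * A + s * B) ≡ n * (a + A) + s * (b + B)
  regroupʳ = ℕ-Solver.solve-∀

sum-map-zero : (c : A → ℕ) {xs : List A} → All (λ x → c x ≡ 0) xs → sum (map c xs) ≡ 0
sum-map-zero c []       = refl
sum-map-zero c (e ∷ es) = cong₂ _+_ e (sum-map-zero c es)

add-equations : ∀ {x y d d′ e e′ a b} →
  x + d * a ≡ e * a + d * b → y + d′ * a ≡ e′ * a + d′ * b →
  (x + y) + (d + d′) * a ≡ (e + e′) * a + (d + d′) * b
add-equations {x} {y} {d} {d′} {e} {e′} {a} {b} eq eq′ = begin
    (x + y) + (d + d′) * a
  ≡⟨ regroupˡ x y d d′ a ⟩
    (x + d * a) + (y + d′ * a)
  ≡⟨ cong₂ _+_ eq eq′ ⟩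
    (e * a + d * b) + (e′ * a + d′ * b)
  ≡⟨ regroupʳ e e′ d d′ a b ⟩
    (e + e′) * a + (d + d′) * b ∎
  where
  open ≡-Reasoning
  regroupˡ : ∀ x y d d′ a → (x + y) + (d + d′) * a ≡ (x + d * a) + (y + d′ * a)
  regroupˡ = ℕ-Solver.solve-∀
  regroupʳ : ∀ e e′ d d′ a b → (e * a + d * b) + (e′ * a + d′ * b) ≡ (e + e′) * a + (d + d′) * b
  regroupʳ = ℕ-Solver.solve-∀

-- Permutations

insertions-↭ : ∀ x w → All (_↭ x ∷ w) (insertions x w)
insertions-↭ x []       = ↭-refl ∷ []
insertions-↭ x (y ∷ ys) =
  ↭-refl ∷ All-map⁺ (All.map (λ p → ↭-trans (prep y p) (swap y x ↭-refl)) (insertions-↭ x ys))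

concatMap⁺ : (g : A → List B) {xs ys : List A} → xs ↭ ys → concatMap g xs ↭ concatMap g ys
concatMap⁺ g Perm.refl         = ↭-refl
concatMap⁺ g (Perm.prep x p)   = ++⁺ˡ (g x) (concatMap⁺ g p)
concatMap⁺ g (Perm.swap x y p) = ↭-trans (shifts (g x) (g y)) (++⁺ˡ (g y) (++⁺ˡ (g x) (concatMap⁺ g p)))
concatMap⁺ g (Perm.trans p q)  = ↭-trans (concatMap⁺ g p) (concatMap⁺ g q)

concatMap-insertions-map-∷ : ∀ x z U →
  concatMap (insertions x) (map (z ∷_) U) ↭ map (x ∷_) (map (z ∷_) U) ++ map (z ∷_) (concatMap (insertions x) U)
concatMap-insertions-map-∷ x z []      = ↭-refl
concatMap-insertions-map-∷ x z (u ∷ U) = prep (x ∷ z ∷ u) (begin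
    map (z ∷_) (insertions x u) ++ concatMap (insertions x) (map (z ∷_) U)
  ↭⟨ ++⁺ˡ (map (z ∷_) (insertions x u)) (concatMap-insertions-map-∷ x z U) ⟩
    map (z ∷_) (insertions x u) ++ xzU ++ map (z ∷_) (concatMap (insertions x) U)
  ↭⟨ shifts (map (z ∷_) (insertions x u)) xzU ⟩
    xzU ++ map (z ∷_) (insertions x u) ++ map (z ∷_) (concatMap (insertions x) U)
  ≡⟨ cong (xzU ++_) (map-++ (z ∷_) (insertions x u) (concatMap (insertions x) U)) ⟨
    xzU ++ map (z ∷_) (concatMap (insertions x) (u ∷ U)) ∎)
  where
  open Perm.PermutationReasoning
  xzU = map (x ∷_) (map (z ∷_) U)

insertions-comm : ∀ x y v → concatMap (insertions x) (insertions y v) ↭ concatMap (insertions y) (insertions x v)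
insertions-comm x y []       = swap (x ∷ y ∷ []) (y ∷ x ∷ []) ↭-refl
insertions-comm x y (z ∷ zs) = begin
    xyz ∷ yxz ∷ yzX ++ concatMap (insertions x) (map (z ∷_) (insertions y zs))
  ↭⟨ prep xyz (prep yxz (++⁺ˡ yzX (concatMap-insertions-map-∷ x z (insertions y zs)))) ⟩
    xyz ∷ yxz ∷ yzX ++ xzY ++ map (z ∷_) (concatMap (insertions x) (insertions y zs))
  ↭⟨ swap xyz yxz (shifts yzX xzY) ⟩
    yxz ∷ xyz ∷ xzY ++ yzX ++ map (z ∷_) (concatMap (insertions x) (insertions y zs))
  ↭⟨ prep yxz (prep xyz (++⁺ˡ xzY (++⁺ˡ yzX (map⁺ (z ∷_) (insertions-comm x y zs))))) ⟩
    yxz ∷ xyz ∷ xzY ++ yzX ++ map (z ∷_) (concatMap (insertions y) (insertions x zs))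
  ↭⟨ prep yxz (prep xyz (++⁺ˡ xzY (concatMap-insertions-map-∷ y z (insertions x zs)))) ⟨
    yxz ∷ xyz ∷ xzY ++ concatMap (insertions y) (map (z ∷_) (insertions x zs)) ∎
  where
  open Perm.PermutationReasoning
  xyz = x ∷ y ∷ z ∷ zs
  yxz = y ∷ x ∷ z ∷ zs
  yzX = map (y ∷_) (map (z ∷_) (insertions x zs))
  xzY = map (x ∷_) (map (z ∷_) (insertions y zs))

concatMap-insertions-comm : ∀ x y P →
  concatMap (insertions x) (concatMap (insertions y) P) ↭ concatMap (insertions y) (concatMap (insertions x) P)
concatMap-insertions-comm x y []      = ↭-refl
concatMap-insertions-comm x y (v ∷ P) = begin
    concatMap (insertions x) (insertions y v ++ concatMap (insertions y) P)
  ≡⟨ concatMap-++ (insertions x) (insertions y v) (concatMap (insertions y) P) ⟩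
    concatMap (insertions x) (insertions y v) ++ concatMap (insertions x) (concatMap (insertions y) P)
  ↭⟨ ++⁺ (insertions-comm x y v) (concatMap-insertions-comm x y P) ⟩
    concatMap (insertions y) (insertions x v) ++ concatMap (insertions y) (concatMap (insertions x) P)
  ≡⟨ concatMap-++ (insertions y) (insertions x v) (concatMap (insertions x) P) ⟨
    concatMap (insertions y) (insertions x v ++ concatMap (insertions x) P) ∎
  where open Perm.PermutationReasoning

perms-resp-↭ : ∀ {xs ys} → xs ↭ ys → perms xs ↭ perms ys
perms-resp-↭ Perm.refl         = ↭-refl
perms-resp-↭ (Perm.prep x p)   = concatMap⁺ (insertions x) (perms-resp-↭ p)
perms-resp-↭ (Perm.swap {xs} x y p) =
  ↭-trans (concatMap-insertions-comm x y (perms xs))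
          (concatMap⁺ (insertions y) (concatMap⁺ (insertions x) (perms-resp-↭ p)))
perms-resp-↭ (Perm.trans p q)  = ↭-trans (perms-resp-↭ p) (perms-resp-↭ q)

perms-↭ : ∀ xs → All (_↭ xs) (perms xs)
perms-↭ []       = ↭-refl ∷ []
perms-↭ (x ∷ xs) = concatMap-All (perms-↭ xs)
  where
  concatMap-All : ∀ {P} → All (_↭ xs) P → All (_↭ x ∷ xs) (concatMap (insertions x) P)
  concatMap-All []                = []
  concatMap-All (v↭xs ∷ P↭xs) =
    All-++⁺ (All.map (λ u↭x∷v → ↭-trans u↭x∷v (prep x v↭xs)) (insertions-↭ x _)) (concatMap-All P↭xs)

-- Odd-odd drops of a list of consecutive pairs

<⇒<ᵇ≡true : ∀ {m n} → m < n → (m <ᵇ n) ≡ true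
<⇒<ᵇ≡true {zero}  {suc n} _         = refl
<⇒<ᵇ≡true {suc m} {suc n} (s≤s m<n) = <⇒<ᵇ≡true m<n

<⇒>ᵇ≡false : ∀ {m n} → m < n → (n <ᵇ m) ≡ false
<⇒>ᵇ≡false {zero}  {suc n} _         = refl
<⇒>ᵇ≡false {suc m} {suc n} (s≤s m<n) = <⇒>ᵇ≡false m<n

admissible : ℕ × ℕ → Bool
admissible p = if isDrop p then odd (proj₂ p) else true

oddOddDrop : ℕ × ℕ → Bool
oddOddDrop p = isDrop p ∧ isOddOdd p

-- ps, preceded by pairs of joint admissibility g with o odd-odd drops among them, is admissible
-- and has t odd-odd drops in total.
admissibleWith : Bool → ℕ → ℕ → List (ℕ × ℕ) → Bool
admissibleWith g o t ps = (g ∧ all admissible ps) ∧ (o + count oddOddDrop ps ≡ᵇ t)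

admissibleWith-∷ : ∀ g o t p ps →
  admissibleWith g o t (p ∷ ps) ≡ admissibleWith (g ∧ admissible p) (o + 𝟙 (oddOddDrop p)) t ps
admissibleWith-∷ g o t p ps =
  cong₂ _∧_ (sym (∧-assoc g (admissible p) _)) (cong (_≡ᵇ t) (sym (+-assoc o (𝟙 (oddOddDrop p)) _)))

admissibleWith-shift : ∀ x g o t ps → admissibleWith g (𝟙 x + o) (𝟙 x + t) ps ≡ admissibleWith g o t ps
admissibleWith-shift false g o t ps = refl
admissibleWith-shift true  g o t ps = refl

-- Inserting m into a cycle replaces one of its consecutive pairs (a , b) by (a , m) and (m , b).
splits : ℕ → List (ℕ × ℕ) → List (List (ℕ × ℕ))
splits m []             = []
splits m ((a , b) ∷ ps) = ((a , m) ∷ (m , b) ∷ ps) ∷ map ((a , b) ∷_) (splits m ps)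

Both : (ℕ → Set) → ℕ × ℕ → Set
Both P p = P (proj₁ p) × P (proj₂ p)

admissibleWith-split : ∀ {m a b} → a < m → b < m → ∀ g o t ps →
  admissibleWith g o t ((a , m) ∷ (m , b) ∷ ps) ≡ odd b ∧ admissibleWith g (𝟙 (odd m) + o) t ps
admissibleWith-split {m} {a} {b} a<m b<m g o t ps
  rewrite <⇒>ᵇ≡false a<m | <⇒<ᵇ≡true b<m with odd b | odd m
... | false | _     = cong (_∧ _) (∧-zeroʳ g)
... | true  | true  = cong ((g ∧ all admissible ps) ∧_) (cong (_≡ᵇ t) (+-suc o _))
... | true  | false = refl

count-splits-head : ∀ g o t a b ps →
  let δ = 𝟙 (oddOddDrop (a , b))
      H = λ s → 𝟙 (admissibleWith g o s ((a , b) ∷ ps))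
  in 𝟙 (odd b ∧ admissibleWith g o t ps) + δ * H t ≡ 𝟙 (odd b) * H t + δ * H (suc t)
count-splits-head g o t a b ps rewrite admissibleWith-∷ g o t (a , b) ps | admissibleWith-∷ g o (suc t) (a , b) ps
  with b <ᵇ a | odd a | odd b
... | false | _     | ob    rewrite ∧-identityʳ g | +-identityʳ o = cong (_+ 0) (𝟙-∧ ob _)
... | true  | false | true  rewrite ∧-identityʳ g | +-identityʳ o = cong (_+ 0) (𝟙-∧ true _)
... | true  | false | false = refl
... | true  | true  | false = refl
... | true  | true  | true  rewrite ∧-identityʳ g | +-comm o 1 = swap-+ (𝟙 (admissibleWith g o t ps)) _
  where
  swap-+ : ∀ x y → x + 1 * y ≡ 1 * y + 1 * x
  swap-+ = ℕ-Solver.solve-∀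

-- Of the N pairs with odd second entry, c are odd-odd drops: the splits contribute
-- (N − c)·[c = t] + c·[c = t + 1], stated here without subtraction.
count-splits : ∀ {m ps} → All (Both (_< m)) ps → ∀ g o t →
  let c = count oddOddDrop ps
      H = λ s → 𝟙 (admissibleWith g o s ps)
  in count (admissibleWith g o (𝟙 (odd m) + t)) (splits m ps) + c * H t
     ≡ count (odd ∘ proj₂) ps * H t + c * H (suc t)
count-splits [] g o t = refl
count-splits {m} {(a , b) ∷ ps} ((a<m , b<m) ∷ below) g o t =
  trans (cong (λ n → n + (δ + c) * H t) (cong₂ _+_ (cong 𝟙 split-head) split-tail))
        (add-equations {d = δ} {d′ = c} {e = 𝟙 (odd b)} {e′ = count (odd ∘ proj₂) ps} {a = H t} {b = H (suc t)}
                       (count-splits-head g o t a b ps) split-rest)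
  where
  δ = 𝟙 (oddOddDrop (a , b))
  c = count oddOddDrop ps
  H = λ s → 𝟙 (admissibleWith g o s ((a , b) ∷ ps))
  T′ = 𝟙 (odd m) + t
  g′ = g ∧ admissible (a , b)
  o′ = o + 𝟙 (oddOddDrop (a , b))
  split-head : admissibleWith g o T′ ((a , m) ∷ (m , b) ∷ ps) ≡ odd b ∧ admissibleWith g o t ps
  split-head = trans (admissibleWith-split a<m b<m g o T′ ps) (cong (odd b ∧_) (admissibleWith-shift (odd m) g o t ps))
  split-tail : count (admissibleWith g o T′) (map ((a , b) ∷_) (splits m ps))
               ≡ count (admissibleWith g′ o′ T′) (splits m ps)
  split-tail = trans (count-map (admissibleWith g o T′) ((a , b) ∷_) (splits m ps))
                     (count-cong (admissibleWith-∷ g o T′ (a , b)) (splits m ps))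
  split-rest : count (admissibleWith g′ o′ T′) (splits m ps) + c * H t
               ≡ count (odd ∘ proj₂) ps * H t + c * H (suc t)
  split-rest rewrite admissibleWith-∷ g o t (a , b) ps | admissibleWith-∷ g o (suc t) (a , b) ps =
    count-splits below g′ o′ t

count-splits-zero : ∀ {m ps} → odd m ≡ true → All (Both (_< m)) ps → ∀ g o →
  count (admissibleWith g o 0) (splits m ps) ≡ 0
count-splits-zero odd-m [] g o = refl
count-splits-zero {m} {(a , b) ∷ ps} odd-m ((a<m , b<m) ∷ below) g o =
  cong₂ _+_ (cong 𝟙 split-head)
    (trans (count-map (admissibleWith g o 0) ((a , b) ∷_) (splits m ps))
      (trans (count-cong (admissibleWith-∷ g o 0 (a , b)) (splits m ps)) (count-splits-zero odd-m below g′ o′)))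
  where
  g′ = g ∧ admissible (a , b)
  o′ = o + 𝟙 (oddOddDrop (a , b))
  split-head : admissibleWith g o 0 ((a , m) ∷ (m , b) ∷ ps) ≡ false
  split-head rewrite admissibleWith-split a<m b<m g o 0 ps | odd-m
    = trans (cong (odd b ∧_) (∧-zeroʳ (g ∧ all admissible ps))) (∧-zeroʳ (odd b))

-- Cycles beginning with 1

pairsFrom-insertions : ∀ h m a w → map (pairsFrom h ∘ (a ∷_)) (insertions m w) ≡ splits m (pairsFrom h (a ∷ w))
pairsFrom-insertions h m a []       = refl
pairsFrom-insertions h m a (y ∷ ys) = cong (((a , m) ∷ (m , y) ∷ pairsFrom h (y ∷ ys)) ∷_) (begin
    map (pairsFrom h ∘ (a ∷_)) (map (y ∷_) (insertions m ys))
  ≡⟨ map-∘ {g = pairsFrom h ∘ (a ∷_)} {f = y ∷_} (insertions m ys) ⟨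
    map (((a , y) ∷_) ∘ (pairsFrom h ∘ (y ∷_))) (insertions m ys)
  ≡⟨ map-∘ {g = (a , y) ∷_} {f = pairsFrom h ∘ (y ∷_)} (insertions m ys) ⟩
    map ((a , y) ∷_) (map (pairsFrom h ∘ (y ∷_)) (insertions m ys))
  ≡⟨ cong (map ((a , y) ∷_)) (pairsFrom-insertions h m y ys) ⟩
    map ((a , y) ∷_) (splits m (pairsFrom h (y ∷ ys))) ∎)
  where open ≡-Reasoning

pairsFrom-All : ∀ {P : ℕ → Set} {h a w} → P h → All P (a ∷ w) → All (Both P) (pairsFrom h (a ∷ w))
pairsFrom-All {w = []}     ph (pa ∷ [])      = (pa , ph) ∷ []
pairsFrom-All {w = y ∷ ys} ph (pa ∷ py ∷ ps) = (pa , py) ∷ pairsFrom-All ph (py ∷ ps)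

map-proj₂-pairsFrom : ∀ h a w → map proj₂ (pairsFrom h (a ∷ w)) ≡ w ∷ʳ h
map-proj₂-pairsFrom h a []       = refl
map-proj₂-pairsFrom h a (y ∷ ys) = cong (y ∷_) (map-proj₂-pairsFrom h y ys)

count-odd-cyclicPairs : ∀ h w → count (odd ∘ proj₂) (cyclicPairs (h ∷ w)) ≡ count odd (h ∷ w)
count-odd-cyclicPairs h w = begin
    count (odd ∘ proj₂) (pairsFrom h (h ∷ w))
  ≡⟨ count-map odd proj₂ (pairsFrom h (h ∷ w)) ⟨
    count odd (map proj₂ (pairsFrom h (h ∷ w)))
  ≡⟨ cong (count odd) (map-proj₂-pairsFrom h h w) ⟩
    count odd (w ∷ʳ h)
  ≡⟨ count-↭ odd (∷↭∷ʳ h w) ⟨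
    count odd (h ∷ w) ∎
  where open ≡-Reasoning

dropoo≡count : ∀ π → dropoo π ≡ count oddOddDrop (cyclicPairs π)
dropoo≡count π = length-filter-filter isDrop isOddOdd (cyclicPairs π)

-- The checker inside inCo is local to Defs, so inCo can only be unfolded along a concrete cycle;
-- for cycles beginning with 1 this works because their first pair (1 , suc x) is never a drop.
inCo-∷∷ : ∀ x y t → inCo (1 ∷ suc x ∷ suc y ∷ t) ≡ admissible (suc x , suc y) ∧ inCo (1 ∷ suc y ∷ t)
inCo-∷∷ x y t with y <ᵇ x
... | true  = refl
... | false = refl

inCo≡all-admissible : ∀ w → All (1 ≤_) w → inCo (1 ∷ w) ≡ all admissible (cyclicPairs (1 ∷ w))
inCo≡all-admissible []                  _                  = refl
inCo≡all-admissible (zero ∷ _)          (() ∷ _)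
inCo≡all-admissible (suc x ∷ [])        _                  with 0 <ᵇ x
... | true  = refl
... | false = refl
inCo≡all-admissible (suc x ∷ zero ∷ _)  (_ ∷ () ∷ _)
inCo≡all-admissible (suc x ∷ suc y ∷ t) (_ ∷ 1≤y ∷ 1≤t) =
  trans (inCo-∷∷ x y t) (cong (admissible (suc x , suc y) ∧_) (inCo≡all-admissible (suc y ∷ t) (1≤y ∷ 1≤t)))

inCoWith : ℕ → List ℕ → Bool
inCoWith k π = inCo π ∧ (dropoo π ≡ᵇ k)

inCoWith≡admissibleWith : ∀ k w → All (1 ≤_) w →
  inCoWith k (1 ∷ w) ≡ admissibleWith true 0 k (cyclicPairs (1 ∷ w))
inCoWith≡admissibleWith k w 1≤w =
  cong₂ _∧_ (inCo≡all-admissible w 1≤w) (cong (_≡ᵇ k) (dropoo≡count (1 ∷ w)))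

count-insertions≡count-splits : ∀ {m w} → 1 < m → All (λ x → 1 ≤ x × x < m) w → ∀ t →
  count (inCoWith t ∘ (1 ∷_)) (insertions m w) ≡ count (admissibleWith true 0 t) (splits m (cyclicPairs (1 ∷ w)))
count-insertions≡count-splits {m} {w} 1<m range t = begin
    count (inCoWith t ∘ (1 ∷_)) (insertions m w)
  ≡⟨ count-cong-All (All.map (λ {w′} w′↭m∷w → inCoWith≡admissibleWith t w′ (All-resp-↭ (↭-sym w′↭m∷w) 1≤m∷w))
                             (insertions-↭ m w)) ⟩
    count (admissibleWith true 0 t ∘ pairsFrom 1 ∘ (1 ∷_)) (insertions m w)
  ≡⟨ count-map (admissibleWith true 0 t) (pairsFrom 1 ∘ (1 ∷_)) (insertions m w) ⟨
    count (admissibleWith true 0 t) (map (pairsFrom 1 ∘ (1 ∷_)) (insertions m w))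
  ≡⟨ cong (count (admissibleWith true 0 t)) (pairsFrom-insertions 1 m 1 w) ⟩
    count (admissibleWith true 0 t) (splits m (cyclicPairs (1 ∷ w))) ∎
  where
  open ≡-Reasoning
  1≤m∷w : All (1 ≤_) (m ∷ w)
  1≤m∷w = <⇒≤ 1<m ∷ All.map proj₁ range

count-insertions : ∀ {m w} → 1 < m → All (λ x → 1 ≤ x × x < m) w → ∀ k →
  count (inCoWith (𝟙 (odd m) + k) ∘ (1 ∷_)) (insertions m w) + k * 𝟙 (inCoWith k (1 ∷ w))
  ≡ count odd (1 ∷ w) * 𝟙 (inCoWith k (1 ∷ w)) + suc k * 𝟙 (inCoWith (suc k) (1 ∷ w))
count-insertions {m} {w} 1<m range k = begin
    count (inCoWith K ∘ (1 ∷_)) (insertions m w) + k * 𝟙 (inCoWith k (1 ∷ w))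
  ≡⟨ cong₂ (λ x y → x + k * 𝟙 y)
           (count-insertions≡count-splits 1<m range K) (inCoWith≡admissibleWith k w 1≤w) ⟩
    count (admissibleWith true 0 K) (splits m ps) + k * χ k
  ≡⟨ cong (λ x → count (admissibleWith true 0 K) (splits m ps) + x) (*-𝟙-≡ᵇ c k (all admissible ps)) ⟨
    count (admissibleWith true 0 K) (splits m ps) + c * χ k
  ≡⟨ count-splits (pairsFrom-All 1<m (1<m ∷ All.map proj₂ range)) true 0 k ⟩
    count (odd ∘ proj₂) ps * χ k + c * χ (suc k)
  ≡⟨ cong₂ (λ x y → x * χ k + y) (count-odd-cyclicPairs 1 w) (*-𝟙-≡ᵇ c (suc k) (all admissible ps)) ⟩
    count odd (1 ∷ w) * χ k + suc k * χ (suc k)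
  ≡⟨ cong₂ (λ x y → count odd (1 ∷ w) * 𝟙 x + suc k * 𝟙 y)
           (inCoWith≡admissibleWith k w 1≤w) (inCoWith≡admissibleWith (suc k) w 1≤w) ⟨
    count odd (1 ∷ w) * 𝟙 (inCoWith k (1 ∷ w)) + suc k * 𝟙 (inCoWith (suc k) (1 ∷ w)) ∎
  where
  open ≡-Reasoning
  K = 𝟙 (odd m) + k
  ps = cyclicPairs (1 ∷ w)
  c = count oddOddDrop ps
  χ = λ s → 𝟙 (admissibleWith true 0 s ps)
  1≤w = All.map proj₁ range

count-insertions-zero : ∀ {m w} → odd m ≡ true → 1 < m → All (λ x → 1 ≤ x × x < m) w →
  count (inCoWith 0 ∘ (1 ∷_)) (insertions m w) ≡ 0
count-insertions-zero odd-m 1<m range =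
  trans (count-insertions≡count-splits 1<m range 0)
        (count-splits-zero odd-m (pairsFrom-All 1<m (1<m ∷ All.map proj₂ range)) true 0)

-- Cycles on [j + 1]

tailEntries : ℕ → List ℕ
tailEntries j = map (λ i → suc (suc i)) (upTo j)

tailEntries-suc : ∀ j → tailEntries (suc j) ≡ tailEntries j ∷ʳ suc (suc j)
tailEntries-suc j =
  trans (cong (map (λ i → suc (suc i))) (sym (upTo-∷ʳ j))) (map-++ (λ i → suc (suc i)) (upTo j) (j ∷ []))

tailEntries-range : ∀ j → All (λ x → 1 ≤ x × x < 2 + j) (tailEntries j)
tailEntries-range j = All-map⁺ (applyUpTo⁺₁ (λ i → i) j (λ i<j → s≤s z≤n , s≤s (s≤s i<j)))

perms-tailEntries-suc : ∀ j → perms (tailEntries (suc j)) ↭ concatMap (insertions (2 + j)) (perms (tailEntries j))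
perms-tailEntries-suc j =
  subst (λ l → perms l ↭ perms (2 + j ∷ tailEntries j)) (sym (tailEntries-suc j))
        (perms-resp-↭ (↭-sym (∷↭∷ʳ (2 + j) (tailEntries j))))

odd-2+2* : ∀ n → odd (2 + 2 * n) ≡ false
odd-2+2* n = trans (cong (λ x → (2 + x) % 2 ≡ᵇ 1) (*-comm 2 n)) (cong (_≡ᵇ 1) ([m+kn]%n≡m%n 0 (suc n) 2))

odd-3+2* : ∀ n → odd (3 + 2 * n) ≡ true
odd-3+2* n = trans (cong (λ x → (3 + x) % 2 ≡ᵇ 1) (*-comm 2 n)) (cong (_≡ᵇ 1) ([m+kn]%n≡m%n 1 (suc n) 2))

oddCount : ℕ → ℕ
oddCount j = count odd (1 ∷ tailEntries j)

oddCount-suc : ∀ j → oddCount (suc j) ≡ oddCount j + 𝟙 (odd (2 + j))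
oddCount-suc j = cong suc (begin
    count odd (tailEntries (suc j))
  ≡⟨ cong (count odd) (tailEntries-suc j) ⟩
    count odd (tailEntries j ∷ʳ suc (suc j))
  ≡⟨ count-++ odd (tailEntries j) (suc (suc j) ∷ []) ⟩
    count odd (tailEntries j) + (𝟙 (odd (2 + j)) + 0)
  ≡⟨ cong (λ n → count odd (tailEntries j) + n) (+-identityʳ _) ⟩
    count odd (tailEntries j) + 𝟙 (odd (2 + j)) ∎)
  where open ≡-Reasoning

oddCount-2* : ∀ n → oddCount (2 * n) ≡ suc n
oddCount-1+2* : ∀ n → oddCount (1 + 2 * n) ≡ suc n

oddCount-2* zero    = refl
oddCount-2* (suc n) = begin
    oddCount (2 * suc n)
  ≡⟨ cong oddCount (*-suc 2 n) ⟩
    oddCount (2 + 2 * n)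
  ≡⟨ oddCount-suc (1 + 2 * n) ⟩
    oddCount (1 + 2 * n) + 𝟙 (odd (3 + 2 * n))
  ≡⟨ cong₂ _+_ (oddCount-1+2* n) (cong 𝟙 (odd-3+2* n)) ⟩
    suc n + 1
  ≡⟨ +-comm (suc n) 1 ⟩
    suc (suc n) ∎
  where open ≡-Reasoning

oddCount-1+2* n =
  trans (oddCount-suc (2 * n)) (trans (cong₂ _+_ (oddCount-2* n) (cong 𝟙 (odd-2+2* n))) (+-identityʳ (suc n)))

count-cycles-step : ∀ j k →
  let a = λ s → count (inCoWith s ∘ (1 ∷_)) (perms (tailEntries j))
  in count (inCoWith (𝟙 (odd (2 + j)) + k) ∘ (1 ∷_)) (perms (tailEntries (suc j))) + k * a k
     ≡ oddCount j * a k + suc k * a (suc k)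
count-cycles-step j k =
  trans (cong (λ x → x + k * a k)
              (trans (count-↭ P (perms-tailEntries-suc j)) (count-concatMap P (insertions (2 + j)) Ws)))
        (sum-map-linear (count P ∘ insertions (2 + j)) (χ k) (χ (suc k)) k (oddCount j) (suc k)
                        (All.map insertion-identity (perms-↭ (tailEntries j))))
  where
  P = inCoWith (𝟙 (odd (2 + j)) + k) ∘ (1 ∷_)
  Ws = perms (tailEntries j)
  χ = λ s w → 𝟙 (inCoWith s (1 ∷ w))
  a = λ s → count (inCoWith s ∘ (1 ∷_)) Ws
  insertion-identity : ∀ {w} → w ↭ tailEntries j →
    count P (insertions (2 + j) w) + k * χ k w ≡ oddCount j * χ k w + suc k * χ (suc k) w
  insertion-identity {w} w↭ =
    subst (λ N → count P (insertions (2 + j) w) + k * χ k w ≡ N * χ k w + suc k * χ (suc k) w)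
          (count-↭ odd (prep 1 w↭))
    (count-insertions (s≤s (s≤s z≤n)) (All-resp-↭ (↭-sym w↭) (tailEntries-range j)) k)

count-cycles-zero : ∀ j → odd (2 + j) ≡ true → count (inCoWith 0 ∘ (1 ∷_)) (perms (tailEntries (suc j))) ≡ 0
count-cycles-zero j odd-m =
  trans (count-↭ P (perms-tailEntries-suc j))
        (trans (count-concatMap P (insertions (2 + j)) (perms (tailEntries j)))
               (sum-map-zero (count P ∘ insertions (2 + j)) (All.map no-constant-term (perms-↭ (tailEntries j)))))
  where
  P = inCoWith 0 ∘ (1 ∷_)
  no-constant-term : ∀ {w} → w ↭ tailEntries j → count P (insertions (2 + j) w) ≡ 0
  no-constant-term w↭ = count-insertions-zero odd-m (s≤s (s≤s z≤n)) (All-resp-↭ (↭-sym w↭) (tailEntries-range j))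

f-suc≡count : ∀ j k → f (suc j) k ≡ + count (inCoWith k ∘ (1 ∷_)) (perms (tailEntries j))
f-suc≡count j k =
  cong +_ (trans (length-filter (inCoWith k) (cycles (suc j))) (count-map (inCoWith k) (1 ∷_) (perms (tailEntries j))))

ℕ-equation⇒ℤ : ∀ {c k n a s b} → c + k * a ≡ n * a + s * b →
  + c ≡ (+ n ℤ.* + a ℤ.- + k ℤ.* + a) ℤ.+ + s ℤ.* + b
ℕ-equation⇒ℤ {c} {k} {n} {a} {s} {b} eq = begin
    + c
  ≡⟨ add-sub (+ c) (+ k ℤ.* + a) ⟩
    (+ c ℤ.+ + k ℤ.* + a) ℤ.- + k ℤ.* + a
  ≡⟨ cong (ℤ._- + k ℤ.* + a) lifted ⟩
    (+ n ℤ.* + a ℤ.+ + s ℤ.* + b) ℤ.- + k ℤ.* + a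
  ≡⟨ regroup (+ n ℤ.* + a) (+ s ℤ.* + b) (+ k ℤ.* + a) ⟩
    (+ n ℤ.* + a ℤ.- + k ℤ.* + a) ℤ.+ + s ℤ.* + b ∎
  where
  open ≡-Reasoning
  add-sub : ∀ x y → x ≡ (x ℤ.+ y) ℤ.- y
  add-sub = ℤ-Solver.solve-∀
  regroup : ∀ x y z → (x ℤ.+ y) ℤ.- z ≡ (x ℤ.- z) ℤ.+ y
  regroup = ℤ-Solver.solve-∀
  lifted : + c ℤ.+ + k ℤ.* + a ≡ + n ℤ.* + a ℤ.+ + s ℤ.* + b
  lifted = begin
      + c ℤ.+ + k ℤ.* + a
    ≡⟨ cong (λ x → + c ℤ.+ x) (ℤ.pos-* k a) ⟨
      + c ℤ.+ + (k * a)
    ≡⟨ ℤ.pos-+ c (k * a) ⟨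
      + (c + k * a)
    ≡⟨ cong +_ eq ⟩
      + (n * a + s * b)
    ≡⟨ ℤ.pos-+ (n * a) (s * b) ⟩
      + (n * a) ℤ.+ + (s * b)
    ≡⟨ cong₂ ℤ._+_ (ℤ.pos-* n a) (ℤ.pos-* s b) ⟩
      + n ℤ.* + a ℤ.+ + s ℤ.* + b ∎

Φ : ℕ → Poly → Poly
Φ n p = (+ n) · p ⊖ X (D p) ⊕ D p

X-D : ∀ p k → X (D p) k ≡ + k ℤ.* p k
X-D p zero    = refl
X-D p (suc k) = refl

X-Φ : ∀ n p → X (Φ n p) ≋ (+ n) · X p ⊖ X (X (D p)) ⊕ X (D p)
X-Φ n p zero    = sym (cong (λ x → (x ℤ.- + 0) ℤ.+ + 0) (ℤ.*-zeroʳ (+ n)))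
X-Φ n p (suc k) = refl

f-insert-max : ∀ j k → f (2 + j) (𝟙 (odd (2 + j)) + k) ≡ Φ (oddCount j) (f (1 + j)) k
f-insert-max j k = begin
    f (2 + j) (𝟙 (odd (2 + j)) + k)
  ≡⟨ f-suc≡count (suc j) (𝟙 (odd (2 + j)) + k) ⟩
    + count (inCoWith (𝟙 (odd (2 + j)) + k) ∘ (1 ∷_)) (perms (tailEntries (suc j)))
  ≡⟨ ℕ-equation⇒ℤ {k = k} {n = N} {a = a k} {s = suc k} {b = a (suc k)} (count-cycles-step j k) ⟩
    (+ N ℤ.* + a k ℤ.- + k ℤ.* + a k) ℤ.+ + suc k ℤ.* + a (suc k)
  ≡⟨ cong₂ (λ x y → (+ N ℤ.* x ℤ.- + k ℤ.* x) ℤ.+ + suc k ℤ.* y)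
           (f-suc≡count j k) (f-suc≡count j (suc k)) ⟨
    (+ N ℤ.* f (1 + j) k ℤ.- + k ℤ.* f (1 + j) k) ℤ.+ D (f (1 + j)) k
  ≡⟨ cong (λ x → (+ N ℤ.* f (1 + j) k ℤ.- x) ℤ.+ D (f (1 + j)) k) (X-D (f (1 + j)) k) ⟨
    Φ N (f (1 + j)) k ∎
  where
  open ≡-Reasoning
  N = oddCount j
  a = λ s → count (inCoWith s ∘ (1 ∷_)) (perms (tailEntries j))

f-even : ∀ n → f (2 + 2 * n) ≋ Φ (suc n) (f (1 + 2 * n))
f-even n k = subst₂ (λ b N → f (2 + 2 * n) (𝟙 b + k) ≡ Φ N (f (1 + 2 * n)) k) (odd-2+2* n) (oddCount-2* n)
  (f-insert-max (2 * n) k)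

f-odd : ∀ n → f (3 + 2 * n) ≋ X (Φ (suc n) (f (2 + 2 * n)))
f-odd n zero    = trans (f-suc≡count (2 + 2 * n) 0) (cong +_ (count-cycles-zero (1 + 2 * n) (odd-3+2* n)))
f-odd n (suc k) = subst₂ (λ b N → f (3 + 2 * n) (𝟙 b + k) ≡ Φ N (f (2 + 2 * n)) k) (odd-3+2* n) (oddCount-1+2* n)
  (f-insert-max (1 + 2 * n) k)

lemma3p1 : (f 1 ≋ one)
    × (∀ (n : ℕ) → 1 ≤ n →
         f (2 * n) ≋ (+ n) · f (2 * n ∸ 1) ⊖ X (D (f (2 * n ∸ 1))) ⊕ D (f (2 * n ∸ 1)))
    × (∀ (n : ℕ) → 1 ≤ n →
         f (2 * n + 1) ≋ (+ n) · X (f (2 * n)) ⊖ X (X (D (f (2 * n)))) ⊕ X (D (f (2 * n))))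
lemma3p1 = f-one , even-step , odd-step
  where
  f-one : f 1 ≋ one
  f-one zero    = refl
  f-one (suc k) = refl
  even-step : ∀ n → 1 ≤ n → f (2 * n) ≋ Φ n (f (2 * n ∸ 1))
  even-step (suc n) _ = subst (λ m → f m ≋ Φ (suc n) (f (m ∸ 1))) (sym (*-suc 2 n)) (f-even n)
  odd-step : ∀ n → 1 ≤ n → f (2 * n + 1) ≋ (+ n) · X (f (2 * n)) ⊖ X (X (D (f (2 * n)))) ⊕ X (D (f (2 * n)))
  odd-step (suc n) _ =
    subst₂ (λ m m′ → f m′ ≋ (+ suc n) · X (f m) ⊖ X (X (D (f m))) ⊕ X (D (f m)))
           (sym (*-suc 2 n)) (trans (cong suc (sym (*-suc 2 n))) (+-comm 1 (2 * suc n)))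
           (λ k → trans (f-odd n k) (X-Φ (suc n) (f (2 + 2 * n)) k))
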